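{- Let $\{2,a,b,c\}$ be a regular Diophantine quadruple. Then the Diophantine triple $\{a,b,c\}$ is also a $D(n)$-set for two distinct $n$'s with $n\neq 1$.
   Context: For a nonzero integer $n$, a set of distinct nonzero integers $\{a_1,\ldots,a_m\}$ such that $a_ia_j+n$ is a perfect square for all $1\le i<j\le m$ is called a $D(n)$-set; a $D(1)$-set is called a Diophantine $m$-tuple. For a Diophantine triple $\{a,b,c\}$ with $bc+1=r^2$, $ca+1=s^2$, $ab+1=t^2$ ($r,s,t$ positive integers), the Diophantine quadruple $\{a,b,c,d\}$ with $d=a+b+c+2abc+2rst$ is called regular; more generally, a Diophantine quadruple $\{a,b,c,d\}$ is regular if $(a+b-c-d)^2=4(ab+1)(cd+1)$. In particular, $\{2,a,b,c\}$ is a regular Diophantine quadruple exactly when $\{2,a,b\}$ is a Diophantine triple and $c=2+a+b+4ab\pm 2\sqrt{(2a+1)(2b+1)(ab+1)}$. -}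

module Defs where

open import Data.Integer using (ℤ; _+_; _*_; _-_; +_)
open import Data.Product using (_×_; ∃)
open import Relation.Binary.PropositionalEquality using (_≡_; _≢_)

IsSquare : ℤ → Set
IsSquare x = ∃ λ k → x ≡ k * k

DSet3 : ℤ → ℤ → ℤ → ℤ → Set
DSet3 n a b c =
  n ≢ + 0 × a ≢ + 0 × b ≢ + 0 × c ≢ + 0 ×
  a ≢ b × a ≢ c × b ≢ c ×
  IsSquare (a * b + n) × IsSquare (a * c + n) × IsSquare (b * c + n)

DSet4 : ℤ → ℤ → ℤ → ℤ → ℤ → Set
DSet4 n a b c d =
  n ≢ + 0 × a ≢ + 0 × b ≢ + 0 × c ≢ + 0 × d ≢ + 0 ×
  a ≢ b × a ≢ c × a ≢ d × b ≢ c × b ≢ d × c ≢ d ×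
  IsSquare (a * b + n) × IsSquare (a * c + n) × IsSquare (a * d + n) ×
  IsSquare (b * c + n) × IsSquare (b * d + n) × IsSquare (c * d + n)

DiophantineQuadruple : ℤ → ℤ → ℤ → ℤ → Set
DiophantineQuadruple a b c d = DSet4 (+ 1) a b c d

RegularDiophantineQuadruple : ℤ → ℤ → ℤ → ℤ → Set
RegularDiophantineQuadruple a b c d =
  DiophantineQuadruple a b c d ×
  (a + b - c - d) * (a + b - c - d) ≡ + 4 * (a * b + + 1) * (c * d + + 1)

module Submission where

-- Let {2, a, b, c} be a regular Diophantine quadruple.  We show that {a, b, c}
-- is a D(n)-set for  n₁ = a + b + c  and  n₂ = a + b + c + 2abc.
--
-- Write 2a + 1 = x² and bc + 1 = w².  Regularity says (2 + a - b - c)² = (2xw)²,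
-- so after possibly replacing x by -x we have 2 + a - b - c = 2xw, and then
--   bc + n₁ = (bc + 1) + (2a + 1) - (2 + a - b - c) = (w - x)²,
--   bc + n₂ = (bc + 1)(2a + 1) - (2 + a - b - c) + 1 = (wx - 1)².
-- The regularity equation is symmetric in a, b, c, so the same argument applies
-- to the pairs {a, b} and {a, c}.  Finally 2a + 1 is a square, so a ≥ 1, and
-- likewise b, c ≥ 1; hence 3 ≤ n₁ < n₂, which makes n₁, n₂ distinct, nonzero
-- and different from 1.

open import Defs
open import Data.Nat using (zero; suc; z≤n; s≤s)
open import Data.Nat.Properties using (+-mono-≤)
open import Data.Integer
open import Data.Integer.Properties
  using (i-j≡0⇒i≡j; i*j≡0⇒i≡0∨j≡0; +-inverseʳ; +-identityˡ; +-identityʳ;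
         +-monoʳ-<; <⇒≢; <⇒≤; ≤-trans)
open import Data.Integer.Tactic.RingSolver using (solve-∀)
open import Data.Product using (_×_; _,_; proj₁; proj₂; ∃; ∃₂)
open import Data.Sum using (_⊎_; inj₁; inj₂)
open import Relation.Nullary using (contradiction)
open import Relation.Binary.PropositionalEquality
open ≡-Reasoning

n₁ n₂ : ℤ → ℤ → ℤ → ℤ
n₁ a b c = a + b + c
n₂ a b c = a + b + c + + 2 * a * b * c

Regular₂ : ℤ → ℤ → ℤ → Set
Regular₂ r p q =
  (+ 2 + r - p - q) * (+ 2 + r - p - q) ≡ + 4 * (+ 2 * r + + 1) * (p * q + + 1)

PairSquares : ℤ → ℤ → ℤ → ℤ → Set
PairSquares n a b c = IsSquare (a * b + n) × IsSquare (a * c + n) × IsSquare (b * c + n)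

square-roots : ∀ u v → u * u ≡ v * v → u ≡ v ⊎ u ≡ - v
square-roots u v eq with i*j≡0⇒i≡0∨j≡0 (u - v) {u + v} product-zero
  where
  difference-of-squares : ∀ u v → (u - v) * (u + v) ≡ u * u - v * v
  difference-of-squares = solve-∀
  product-zero : (u - v) * (u + v) ≡ + 0
  product-zero = begin
    (u - v) * (u + v) ≡⟨ difference-of-squares u v ⟩
    u * u - v * v     ≡⟨ cong (_- v * v) eq ⟩
    v * v - v * v     ≡⟨ +-inverseʳ (v * v) ⟩
    + 0               ∎
... | inj₁ u-v≡0 = inj₁ (i-j≡0⇒i≡j u v u-v≡0)
... | inj₂ u+v≡0 = inj₂ (begin
  u             ≡⟨ add-subtract u v ⟩
  u + v - v     ≡⟨ cong (_- v) u+v≡0 ⟩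
  + 0 - v       ≡⟨ +-identityˡ (- v) ⟩
  - v           ∎)
  where
  add-subtract : ∀ u v → u ≡ u + v - v
  add-subtract = solve-∀

defect : ℤ → ℤ → ℤ → ℤ
defect r p q = (+ 2 + r - p - q) * (+ 2 + r - p - q) - + 4 * (+ 2 * r + + 1) * (p * q + + 1)

regular-transfer : ∀ r p q r′ p′ q′ → defect r p q ≡ defect r′ p′ q′ →
  Regular₂ r p q → Regular₂ r′ p′ q′
regular-transfer r p q r′ p′ q′ same reg =
  i-j≡0⇒i≡j _ _ (trans (sym same) (trans (cong (_- rhs) reg) (+-inverseʳ rhs)))
  where
  rhs : ℤ
  rhs = + 4 * (+ 2 * r + + 1) * (p * q + + 1)

-- The defect is a symmetric polynomial in r, p, q, so regularity of {2, a, b, c}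
-- can be read from the point of view of b or of c.
regular-permute : ∀ a b c → Regular₂ a b c → Regular₂ b a c × Regular₂ c a b
regular-permute a b c reg =
  regular-transfer a b c b a c (swap a b c) reg ,
  regular-transfer a b c c a b (rotate a b c) reg
  where
  -- the defects written out, so that the ring solver can see the polynomials
  swap : ∀ a b c →
    (+ 2 + a - b - c) * (+ 2 + a - b - c) - + 4 * (+ 2 * a + + 1) * (b * c + + 1) ≡
    (+ 2 + b - a - c) * (+ 2 + b - a - c) - + 4 * (+ 2 * b + + 1) * (a * c + + 1)
  swap = solve-∀
  rotate : ∀ a b c →
    (+ 2 + a - b - c) * (+ 2 + a - b - c) - + 4 * (+ 2 * a + + 1) * (b * c + + 1) ≡
    (+ 2 + c - a - b) * (+ 2 + c - a - b) - + 4 * (+ 2 * c + + 1) * (a * b + + 1)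
  rotate = solve-∀

pair-squares-signed : ∀ r p q x w → + 2 * r + + 1 ≡ x * x → p * q + + 1 ≡ w * w →
  + 2 + r - p - q ≡ + 2 * x * w →
  IsSquare (p * q + n₁ r p q) × IsSquare (p * q + n₂ r p q)
pair-squares-signed r p q x w hx hw root = (w - x , first) , (w * x - + 1 , second)
  where
  split₁ : ∀ r p q → p * q + (r + p + q) ≡ (p * q + + 1) + (+ 2 * r + + 1) - (+ 2 + r - p - q)
  split₁ = solve-∀
  square₁ : ∀ x w → w * w + x * x - + 2 * x * w ≡ (w - x) * (w - x)
  square₁ = solve-∀
  split₂ : ∀ r p q → p * q + (r + p + q + + 2 * r * p * q) ≡
                     (p * q + + 1) * (+ 2 * r + + 1) - (+ 2 + r - p - q) + + 1
  split₂ = solve-∀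
  square₂ : ∀ x w → w * w * (x * x) - + 2 * x * w + + 1 ≡ (w * x - + 1) * (w * x - + 1)
  square₂ = solve-∀
  first : p * q + n₁ r p q ≡ (w - x) * (w - x)
  first = begin
    p * q + n₁ r p q                                        ≡⟨ split₁ r p q ⟩
    (p * q + + 1) + (+ 2 * r + + 1) - (+ 2 + r - p - q)     ≡⟨ cong₂ _-_ (cong₂ _+_ hw hx) root ⟩
    w * w + x * x - + 2 * x * w                             ≡⟨ square₁ x w ⟩
    (w - x) * (w - x)                                       ∎
  second : p * q + n₂ r p q ≡ (w * x - + 1) * (w * x - + 1)
  second = begin
    p * q + n₂ r p q                                        ≡⟨ split₂ r p q ⟩
    (p * q + + 1) * (+ 2 * r + + 1) - (+ 2 + r - p - q) + + 1
      ≡⟨ cong (_+ + 1) (cong₂ _-_ (cong₂ _*_ hw hx) root) ⟩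
    w * w * (x * x) - + 2 * x * w + + 1                     ≡⟨ square₂ x w ⟩
    (w * x - + 1) * (w * x - + 1)                           ∎

-- One pair {p, q} of a regular quadruple {2, r, p, q}: regularity gives
-- 2 + r - p - q = ±2xw, and the sign is absorbed by replacing x with -x.
pair-squares : ∀ r p q → Regular₂ r p q →
  IsSquare (+ 2 * r + + 1) → IsSquare (p * q + + 1) →
  IsSquare (p * q + n₁ r p q) × IsSquare (p * q + n₂ r p q)
pair-squares r p q reg (x , hx) (w , hw)
  with square-roots (+ 2 + r - p - q) (+ 2 * x * w) equal-squares
  where
  scale : ∀ x w → + 4 * (x * x) * (w * w) ≡ (+ 2 * x * w) * (+ 2 * x * w)
  scale = solve-∀
  equal-squares : (+ 2 + r - p - q) * (+ 2 + r - p - q) ≡ (+ 2 * x * w) * (+ 2 * x * w)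
  equal-squares = trans reg (trans (cong₂ (λ s t → + 4 * s * t) hx hw) (scale x w))
... | inj₁ plus  = pair-squares-signed r p q x w hx hw plus
... | inj₂ minus =
  pair-squares-signed r p q (- x) w (trans hx (negate-square x)) hw (trans minus (negate-factor x w))
  where
  negate-square : ∀ x → x * x ≡ (- x) * (- x)
  negate-square = solve-∀
  negate-factor : ∀ x w → - (+ 2 * x * w) ≡ + 2 * (- x) * w
  negate-factor = solve-∀

-- n₁ and n₂ are symmetric functions of a, b, c; we need the two permutations
-- matching the two readings of regularity in regular-permute.
shifts-swap : ∀ a b c → n₁ b a c ≡ n₁ a b c × n₂ b a c ≡ n₂ a b c
shifts-swap a b c = swap₁ a b c , swap₂ a b c
  where
  swap₁ : ∀ a b c → b + a + c ≡ a + b + c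
  swap₁ = solve-∀
  swap₂ : ∀ a b c → b + a + c + + 2 * b * a * c ≡ a + b + c + + 2 * a * b * c
  swap₂ = solve-∀

shifts-rotate : ∀ a b c → n₁ c a b ≡ n₁ a b c × n₂ c a b ≡ n₂ a b c
shifts-rotate a b c = rotate₁ a b c , rotate₂ a b c
  where
  rotate₁ : ∀ a b c → c + a + b ≡ a + b + c
  rotate₁ = solve-∀
  rotate₂ : ∀ a b c → c + a + b + + 2 * c * a * b ≡ a + b + c + + 2 * a * b * c
  rotate₂ = solve-∀

move-shifts : ∀ x {m₁ m₂ k₁ k₂} → m₁ ≡ k₁ × m₂ ≡ k₂ →
  IsSquare (x + m₁) × IsSquare (x + m₂) → IsSquare (x + k₁) × IsSquare (x + k₂)
move-shifts x (refl , refl) squares = squares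

regular-pair-squares : ∀ a b c → Regular₂ a b c →
  IsSquare (+ 2 * a + + 1) → IsSquare (+ 2 * b + + 1) → IsSquare (+ 2 * c + + 1) →
  IsSquare (a * b + + 1) → IsSquare (a * c + + 1) → IsSquare (b * c + + 1) →
  PairSquares (n₁ a b c) a b c × PairSquares (n₂ a b c) a b c
regular-pair-squares a b c reg sa sb sc sab sac sbc =
  (proj₁ ab , proj₁ ac , proj₁ bc) , (proj₂ ab , proj₂ ac , proj₂ bc)
  where
  ab : IsSquare (a * b + n₁ a b c) × IsSquare (a * b + n₂ a b c)
  ab = move-shifts (a * b) (shifts-rotate a b c)
         (pair-squares c a b (proj₂ (regular-permute a b c reg)) sc sab)
  ac : IsSquare (a * c + n₁ a b c) × IsSquare (a * c + n₂ a b c)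
  ac = move-shifts (a * c) (shifts-swap a b c)
         (pair-squares b a c (proj₁ (regular-permute a b c reg)) sb sac)
  bc : IsSquare (b * c + n₁ a b c) × IsSquare (b * c + n₂ a b c)
  bc = pair-squares a b c reg sa sbc

square-not-negative : ∀ k m → k * k ≢ -[1+ m ]
square-not-negative (+ zero)  m ()
square-not-negative +[1+ k ] m ()
square-not-negative -[1+ k ] m ()

positive-of-square : ∀ {a} → a ≢ + 0 → IsSquare (+ 2 * a + + 1) → ∃ λ i → a ≡ +[1+ i ]
positive-of-square {+ zero}         a≢0 _        = contradiction refl a≢0
positive-of-square {+[1+ i ]}       _   _        = i , refl
positive-of-square { -[1+ zero ]}   _   (k , sq) = contradiction (sym sq) (square-not-negative k _)
positive-of-square { -[1+ suc m ]} _   (k , sq) = contradiction (sym sq) (square-not-negative k _)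

shift-bounds : ∀ i j k → let a = +[1+ i ]; b = +[1+ j ]; c = +[1+ k ] in
  + 3 ≤ n₁ a b c × n₁ a b c < n₂ a b c
shift-bounds i j k = three≤n₁ , n₁<n₂
  where
  a b c : ℤ
  a = +[1+ i ]
  b = +[1+ j ]
  c = +[1+ k ]
  three≤n₁ : + 3 ≤ n₁ a b c
  three≤n₁ = +≤+ (+-mono-≤ (+-mono-≤ (s≤s z≤n) (s≤s z≤n)) (s≤s z≤n))
  -- 2abc is (definitionally) of the form +[1+ _ ], hence positive
  n₁<n₂ : n₁ a b c < n₂ a b c
  n₁<n₂ = subst (_< n₂ a b c) (+-identityʳ (n₁ a b c)) (+-monoʳ-< (n₁ a b c) (+<+ (s≤s z≤n)))

large-shift : ∀ {n} → + 3 ≤ n → n ≢ + 0 × n ≢ + 1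
large-shift (+≤+ (s≤s (s≤s (s≤s _)))) = (λ ()) , (λ ())

shifts-admissible : ∀ {a b c} → a ≢ + 0 → b ≢ + 0 → c ≢ + 0 →
  IsSquare (+ 2 * a + + 1) → IsSquare (+ 2 * b + + 1) → IsSquare (+ 2 * c + + 1) →
  n₁ a b c ≢ n₂ a b c × (n₁ a b c ≢ + 0 × n₁ a b c ≢ + 1) × (n₂ a b c ≢ + 0 × n₂ a b c ≢ + 1)
shifts-admissible a≢0 b≢0 c≢0 sa sb sc
  with positive-of-square a≢0 sa | positive-of-square b≢0 sb | positive-of-square c≢0 sc
... | i , refl | j , refl | k , refl =
  let three≤n₁ , n₁<n₂ = shift-bounds i j k
  in <⇒≢ n₁<n₂ , large-shift three≤n₁ , large-shift (≤-trans three≤n₁ (<⇒≤ n₁<n₂))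

theorem1 : (a b c : ℤ) → RegularDiophantineQuadruple (+ 2) a b c →
    ∃₂ λ n₁ n₂ → n₁ ≢ n₂ × n₁ ≢ + 1 × n₂ ≢ + 1 × DSet3 n₁ a b c × DSet3 n₂ a b c
theorem1 a b c ((_ , _ , a≢0 , b≢0 , c≢0 , _ , _ , _ , a≢b , a≢c , b≢c ,
                 sa , sb , sc , sab , sac , sbc) , reg) =
  let squares₁ , squares₂ = regular-pair-squares a b c reg sa sb sc sab sac sbc
      n₁≢n₂ , (n₁≢0 , n₁≢1) , (n₂≢0 , n₂≢1) = shifts-admissible a≢0 b≢0 c≢0 sa sb sc
  in n₁ a b c , n₂ a b c , n₁≢n₂ , n₁≢1 , n₂≢1 ,
     (n₁≢0 , a≢0 , b≢0 , c≢0 , a≢b , a≢c , b≢c , squares₁) ,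
     (n₂≢0 , a≢0 , b≢0 , c≢0 , a≢b , a≢c , b≢c , squares₂)
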